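{- Let $G=(V,E)$ be a finite simple undirected graph and let $k\ge 3$ be an integer. Let $G_k=(V,E_k)$ be the spanning subgraph of $G$ whose edge set $E_k$ consists of those edges of $G$ that belong to at least one $(k)$-gone of $G$. Then $K_k(G)=K(G_k)$, where $K(G_k)$ denotes the connectivity relation of $G_k$ ($u\,K\,v$ iff $u=v$ or there is a path from $u$ to $v$ in $G_k$).
   Context: A $(k)$-gone of $G$ is a subgraph of $G$ isomorphic to a cycle $C_s$ for some $s$ with $3\le s\le k$. A (vertex) $k$-gonal chain connecting $u$ with $v$ is a finite sequence $(C_1,\dots,C_s)$ of $(k)$-gones of $G$ with $u\in V(C_1)$, $v\in V(C_s)$, and $V(C_{i-1})\cap V(C_i)\neq\emptyset$ for $i=2,\dots,s$. The relation $K_k(G)$ on $V$ is defined by $u\,K_k\,v$ iff $u=v$ or there is a vertex $k$-gonal chain in $G$ connecting $u$ with $v$. -}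

module Defs where

open import Data.Nat using (ℕ; zero; suc; _≤_)
open import Data.Fin using (Fin; inject₁; fromℕ) renaming (zero to fz; suc to fs)
open import Data.Product using (Σ; ∃; _×_; _,_)
open import Data.Sum using (_⊎_)
open import Relation.Binary.PropositionalEquality using (_≡_)
open import Relation.Nullary using (¬_)
open import Relation.Binary.Construct.Closure.ReflexiveTransitive using (Star)
open import Function.Definitions using (Injective)

record Graph (n : ℕ) : Set₁ where
  field
    Adj    : Fin n → Fin n → Set
    sym    : ∀ {u v} → Adj u v → Adj v u
    irrefl : ∀ {u} → ¬ Adj u u
open Graph public

SamePair : ∀ {n} → Fin n → Fin n → Fin n → Fin n → Set
SamePair u v a b = (u ≡ a × v ≡ b) ⊎ (u ≡ b × v ≡ a)

-- A (k)-gone of G: a cycle C_s (s = suc m, 3 ≤ s ≤ k) in G, given by an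
-- injective listing c 0, …, c m of its vertices, with edges
-- c i — c (i+1) (i < m) and c m — c 0, all of which are edges of G.
record Gone {n : ℕ} (G : Graph n) (k : ℕ) : Set where
  field
    m        : ℕ
    three≤s  : 3 ≤ suc m
    s≤k      : suc m ≤ k
    c        : Fin (suc m) → Fin n
    c-inj    : Injective _≡_ _≡_ c
    c-step   : ∀ (i : Fin m) → Adj G (c (inject₁ i)) (c (fs i))
    c-close  : Adj G (c (fromℕ m)) (c fz)
open Gone public

_∈V_ : ∀ {n} {G : Graph n} {k} → Fin n → Gone G k → Set
u ∈V C = ∃ λ i → c C i ≡ u

EdgeOf : ∀ {n} {G : Graph n} {k} → Gone G k → Fin n → Fin n → Set
EdgeOf C u v =
  (∃ λ (i : Fin (m C)) → SamePair u v (c C (inject₁ i)) (c C (fs i)))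
  ⊎ SamePair u v (c C (fromℕ (m C))) (c C fz)

-- A k-gonal chain (C_1, …, C_s) from the gone C_1 = C ending at vertex v:
-- consecutive gones share a vertex, and v lies on the last one.
data ChainTo {n : ℕ} {G : Graph n} {k : ℕ} : Gone G k → Fin n → Set where
  last : ∀ {C : Gone G k} {v : Fin n} → v ∈V C → ChainTo C v
  step : ∀ {C D : Gone G k} {v : Fin n} → (∃ λ (w : Fin n) → w ∈V C × w ∈V D) → ChainTo D v → ChainTo C v

Kk : ∀ {n} → Graph n → ℕ → Fin n → Fin n → Set
Kk G k u v = u ≡ v ⊎ Σ (Gone G k) (λ C → u ∈V C × ChainTo C v)

AdjK : ∀ {n} → Graph n → ℕ → Fin n → Fin n → Set
AdjK G k u v = Adj G u v × Σ (Gone G k) (λ C → EdgeOf C u v)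

Conn : ∀ {n} → (Fin n → Fin n → Set) → Fin n → Fin n → Set
Conn A u v = u ≡ v ⊎ Star A u v

{-# OPTIONS --safe #-}
module Submission where

open import Defs
open import Data.Nat using (ℕ; _≤_; suc)
open import Data.Fin using (Fin; inject₁) renaming (zero to fz; suc to fs)
open import Data.Product using (_×_; _,_)
open import Data.Sum using (inj₁; inj₂)
open import Relation.Binary.PropositionalEquality using (refl)
open import Relation.Binary.Construct.Closure.ReflexiveTransitive using (Star; ε; _◅_; _◅◅_; reverse)
open import Function.Bundles using (_⇔_; mk⇔)

star-from-zero : ∀ {X : Set} {R : X → X → Set} (m : ℕ) (c : Fin (suc m) → X) →
  (∀ (i : Fin m) → R (c (inject₁ i)) (c (fs i))) → ∀ j → Star R (c fz) (c j)
star-from-zero m       c edge fz     = ε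
star-from-zero (suc m) c edge (fs j) = edge fz ◅ star-from-zero m (λ i → c (fs i)) (λ i → edge (fs i)) j

samePair-swap : ∀ {n} {u v a b : Fin n} → SamePair u v a b → SamePair v u a b
samePair-swap (inj₁ (p , q)) = inj₂ (q , p)
samePair-swap (inj₂ (p , q)) = inj₁ (q , p)

module _ {n : ℕ} (G : Graph n) (k : ℕ) where

  edgeOf-sym : ∀ (C : Gone G k) {u v} → EdgeOf C u v → EdgeOf C v u
  edgeOf-sym C (inj₁ (i , p)) = inj₁ (i , samePair-swap p)
  edgeOf-sym C (inj₂ p)       = inj₂ (samePair-swap p)

  adjK-sym : ∀ {u v} → AdjK G k u v → AdjK G k v u
  adjK-sym (e , C , p) = Graph.sym G e , C , edgeOf-sym C p

  gone-connected : (C : Gone G k) → ∀ {x y} → x ∈V C → y ∈V C → Star (AdjK G k) x y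
  gone-connected C (i , refl) (j , refl) = reverse adjK-sym (walk i) ◅◅ walk j
    where
    walk : ∀ j → Star (AdjK G k) (c C fz) (c C j)
    walk = star-from-zero (m C) (c C) (λ i → c-step C i , C , inj₁ (i , inj₁ (refl , refl)))

  chain⇒star : ∀ {C : Gone G k} {u v} → u ∈V C → ChainTo C v → Star (AdjK G k) u v
  chain⇒star {C} uC (last vC)               = gone-connected C uC vC
  chain⇒star {C} uC (step (w , wC , wD) ch) = gone-connected C uC wC ◅◅ chain⇒star wD ch

  samePair-∈V : (C : Gone G k) → ∀ {u v a b} → a ∈V C → b ∈V C → SamePair u v a b → u ∈V C × v ∈V C
  samePair-∈V C aC bC (inj₁ (refl , refl)) = aC , bC
  samePair-∈V C aC bC (inj₂ (refl , refl)) = bC , aC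

  edgeOf-∈V : (C : Gone G k) → ∀ {u v} → EdgeOf C u v → u ∈V C × v ∈V C
  edgeOf-∈V C (inj₁ (i , p)) = samePair-∈V C (_ , refl) (_ , refl) p
  edgeOf-∈V C (inj₂ p)       = samePair-∈V C (_ , refl) (_ , refl) p

  star⇒Kk : ∀ {u v} → Star (AdjK G k) u v → Kk G k u v
  star⇒Kk ε = inj₁ refl
  star⇒Kk (_◅_ {j = w} (_ , C , uw) rest) with edgeOf-∈V C uw | star⇒Kk rest
  ... | uC , wC | inj₁ refl          = inj₂ (C , uC , last wC)
  ... | uC , wC | inj₂ (D , wD , ch) = inj₂ (C , uC , step (w , wC , wD) ch)

theorem11 : ∀ {n : ℕ} (G : Graph n) (k : ℕ) → 3 ≤ k →
    ∀ (u v : Fin n) → Kk G k u v ⇔ Conn (AdjK G k) u v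
theorem11 G k _ u v = mk⇔ to from
  where
  to : Kk G k u v → Conn (AdjK G k) u v
  to (inj₁ u≡v)           = inj₁ u≡v
  to (inj₂ (C , uC , ch)) = inj₂ (chain⇒star G k uC ch)
  from : Conn (AdjK G k) u v → Kk G k u v
  from (inj₁ u≡v) = inj₁ u≡v
  from (inj₂ p)   = star⇒Kk G k p
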